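{- Let $p$ be a prime and let $A$ be a sequence of $\ell\geqslant1$ nonzero elements of $\mathbb{F}_p$ such that $\dim(A)=\ell-1$. Then there exists a basis of $A^\perp$ consisting of minimal elements of $\mathcal{S}_A$.
   Context: For $A=(a_1,\dots,a_\ell)$, $A^\perp=\{x\in\mathbb{F}_p^\ell : \sum_i a_ix_i=0\}$, $\mathcal{S}_A=A^\perp\cap\{0,1\}^\ell$, and $\dim(A)$ is the dimension of the $\mathbb{F}_p$-linear span of $\mathcal{S}_A$. Each $x\in\{0,1\}^\ell$ is identified with the subset $\{i : x_i=1\}$; a minimal element of $\mathcal{S}_A$ is a minimal element of $\mathcal{S}_A\setminus\{0\}$ with respect to inclusion. -}

module Defs where

-- The prime field F_p is modelled as Fin p, with arithmetic mod p
-- (p carries a NonZero instance; primality is a separate hypothesis).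

open import Data.Nat using (ℕ; zero; suc; _+_; _*_; NonZero)
open import Data.Nat.DivMod using (_%_; m%n<n)
open import Data.Fin using (Fin; toℕ; fromℕ<)
open import Data.Bool using (Bool; true; false)
open import Data.Product using (Σ; ∃; _×_)
open import Relation.Binary.PropositionalEquality using (_≡_)
open import Relation.Nullary using (¬_)

Σℕ : ∀ {n} → (Fin n → ℕ) → ℕ
Σℕ {zero}  f = 0
Σℕ {suc n} f = f Fin.zero + Σℕ (λ i → f (Fin.suc i))

module _ (p : ℕ) .{{_ : NonZero p}} where

  red : ℕ → Fin p
  red m = fromℕ< (m%n<n m p)

  Vecₚ : ℕ → Set
  Vecₚ ℓ = Fin ℓ → Fin p

  _≈_ : ∀ {ℓ} → Vecₚ ℓ → Vecₚ ℓ → Set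
  u ≈ v = ∀ i → u i ≡ v i

  isZeroVec : ∀ {ℓ} → Vecₚ ℓ → Set
  isZeroVec v = ∀ i → toℕ (v i) ≡ 0

  _∈⊥_ : ∀ {ℓ} → Vecₚ ℓ → Vecₚ ℓ → Set
  x ∈⊥ A = Σℕ (λ i → toℕ (A i) * toℕ (x i)) % p ≡ 0

  -- a {0,1}-vector (= subset of {1..ℓ}) viewed in F_p^ℓ
  embed : ∀ {ℓ} → (Fin ℓ → Bool) → Vecₚ ℓ
  embed x i with x i
  ... | true  = red 1
  ... | false = red 0

  inS : ∀ {ℓ} → Vecₚ ℓ → (Fin ℓ → Bool) → Set
  inS A x = embed x ∈⊥ A

  _⊆_ : ∀ {ℓ} → (Fin ℓ → Bool) → (Fin ℓ → Bool) → Set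
  x ⊆ y = ∀ i → x i ≡ true → y i ≡ true

  nonEmpty : ∀ {ℓ} → (Fin ℓ → Bool) → Set
  nonEmpty x = ∃ λ i → x i ≡ true

  Minimal : ∀ {ℓ} → Vecₚ ℓ → (Fin ℓ → Bool) → Set
  Minimal A x = inS A x × nonEmpty x ×
    (∀ y → inS A y → nonEmpty y → y ⊆ x → x ⊆ y)

  lincomb : ∀ {k ℓ} → (Fin k → Fin p) → (Fin k → Vecₚ ℓ) → Vecₚ ℓ
  lincomb c v i = red (Σℕ (λ j → toℕ (c j) * toℕ (v j i)))

  _∈Span_ : ∀ {k ℓ} → Vecₚ ℓ → (Fin k → Vecₚ ℓ) → Set
  w ∈Span v = ∃ λ c → lincomb c v ≈ w

  InSpanOf : ∀ {ℓ} → (Vecₚ ℓ → Set) → Vecₚ ℓ → Set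
  InSpanOf {ℓ} P w = Σ ℕ λ k → Σ (Fin k → Vecₚ ℓ) λ v → (∀ j → P (v j)) × (w ∈Span v)

  LinIndep : ∀ {k ℓ} → (Fin k → Vecₚ ℓ) → Set
  LinIndep {k} v = ∀ (c : Fin k → Fin p) → isZeroVec (lincomb c v) → ∀ j → toℕ (c j) ≡ 0

  IsBasis : ∀ {k ℓ} → (Vecₚ ℓ → Set) → (Fin k → Vecₚ ℓ) → Set
  IsBasis W b = (∀ j → W (b j)) × LinIndep b × (∀ w → W w → w ∈Span b)

  SpanS : ∀ {ℓ} → Vecₚ ℓ → Vecₚ ℓ → Set
  SpanS A = InSpanOf (λ v → Σ _ λ x → inS A x × (embed x ≈ v))

  DimIs : ∀ {ℓ} → Vecₚ ℓ → ℕ → Set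
  DimIs {ℓ} A d = Σ (Fin d → Vecₚ ℓ) λ b → IsBasis (SpanS A) b

module Submission where

-- The proof is greedy.  Starting from the empty family, as long as some element of
-- S_A lies outside the span of the current family, adjoin a minimal element of S_A
-- outside that span; one lies below any such element x, because a proper part y of
-- x in S_A splits x into y and x ∖ y, both in S_A (minimal-outside).  The family
-- stays independent (extend-independent), and an independent family in A^⊥ has at
-- most ℓ' members since a vector of A^⊥ is determined by its last ℓ' coordinates
-- (⊥-independent-bound), so the process stops with a family whose span contains S_A.
-- That span contains a basis of span S_A, of ℓ' independent vectors, so the family
-- has at least ℓ' members (independent-bound) and hence spans A^⊥ (⊥-spanned).
--
-- Dimension bounds are proved by counting (an injection F_pⁿ → F_pᵏ forces n ≤ k),
-- F_p-arithmetic is done on natural-number representatives modulo p, and the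
-- searches are decided by enumerating the finite spaces involved.

open import Data.Bool as Bool using (Bool; true; false; _∧_; not)
open import Data.Empty using (⊥-elim)
open import Data.Fin as Fin using (Fin; zero; suc; toℕ; funToFin; finToFun; combine)
open import Data.Fin.Properties
  using (toℕ-injective; toℕ-fromℕ<; toℕ<n; any?; all?; ¬∀⟶∃¬; finToFun-funToFin; funToFin-finToFin; injective⇒≤)
open import Data.Fin.Subset.Properties using (anySubset?)
open import Data.Nat
  using (ℕ; zero; suc; _+_; _*_; _∸_; _^_; _≤_; _<_; _≟_; NonZero; ≢-nonZero; >-nonZero⁻¹; nonTrivial⇒n>1)
open import Data.Nat.Coprimality using (coprime-Bézout; prime⇒coprime)
open import Data.Nat.DivMod
open import Data.Nat.GCD using (module Bézout)
open import Data.Nat.Primality using (Prime; prime⇒nonTrivial)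
open import Data.Nat.Properties
open import Algebra.Properties.Semiring.Sum +-*-semiring
  using (sum; sum-cong-≗; ∑-distrib-+; ∑-comm; *-distribˡ-sum; *-distribʳ-sum)
open import Data.Nat.Tactic.RingSolver using (solve-∀)
open import Data.Product using (Σ; ∃; _×_; _,_; proj₁; proj₂)
import Data.Vec as Vec
open import Data.Vec.Functional using (_∷_)
open import Data.Vec.Properties using (lookup∘tabulate)
open import Function using (_∘_)
open import Relation.Binary.PropositionalEquality
open import Relation.Nullary using (¬_; Dec; yes; no)
open import Relation.Nullary.Decidable using (decidable-stable; _×-dec_; _→-dec_; ¬?)
open import Defs

-- Finite sums.  The sum Σℕ of Defs agrees with the library's sum over the
-- semiring ℕ, from which its algebraic laws are transported.

Σℕ≡sum : ∀ {n} (f : Fin n → ℕ) → Σℕ f ≡ sum f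
Σℕ≡sum {zero}  f = refl
Σℕ≡sum {suc n} f = cong (f zero +_) (Σℕ≡sum (f ∘ suc))

Σℕ-cong : ∀ {n} {f g : Fin n → ℕ} → f ≗ g → Σℕ f ≡ Σℕ g
Σℕ-cong {zero}  f≗g = refl
Σℕ-cong {suc n} f≗g = cong₂ _+_ (f≗g zero) (Σℕ-cong (f≗g ∘ suc))

Σℕ-zero : ∀ n → Σℕ {n} (λ _ → 0) ≡ 0
Σℕ-zero zero    = refl
Σℕ-zero (suc n) = Σℕ-zero n

Σℕ-+ : ∀ {n} (f g : Fin n → ℕ) → Σℕ (λ i → f i + g i) ≡ Σℕ f + Σℕ g
Σℕ-+ f g = begin
  Σℕ (λ i → f i + g i)  ≡⟨ Σℕ≡sum (λ i → f i + g i) ⟩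
  sum (λ i → f i + g i) ≡⟨ ∑-distrib-+ f g ⟩
  sum f + sum g         ≡⟨ cong₂ _+_ (Σℕ≡sum f) (Σℕ≡sum g) ⟨
  Σℕ f + Σℕ g           ∎
  where open ≡-Reasoning

Σℕ-*ˡ : ∀ {n} (a : ℕ) (f : Fin n → ℕ) → Σℕ (λ i → a * f i) ≡ a * Σℕ f
Σℕ-*ˡ a f = begin
  Σℕ (λ i → a * f i)  ≡⟨ Σℕ≡sum (λ i → a * f i) ⟩
  sum (λ i → a * f i) ≡⟨ *-distribˡ-sum a f ⟨
  a * sum f           ≡⟨ cong (a *_) (Σℕ≡sum f) ⟨
  a * Σℕ f            ∎
  where open ≡-Reasoning

Σℕ-*ʳ : ∀ {n} (a : ℕ) (f : Fin n → ℕ) → Σℕ (λ i → f i * a) ≡ Σℕ f * a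
Σℕ-*ʳ a f = begin
  Σℕ (λ i → f i * a)  ≡⟨ Σℕ≡sum (λ i → f i * a) ⟩
  sum (λ i → f i * a) ≡⟨ *-distribʳ-sum a f ⟨
  sum f * a           ≡⟨ cong (_* a) (Σℕ≡sum f) ⟨
  Σℕ f * a            ∎
  where open ≡-Reasoning

Σℕ-comm : ∀ {m n} (f : Fin m → Fin n → ℕ) → Σℕ (λ i → Σℕ (f i)) ≡ Σℕ (λ j → Σℕ (λ i → f i j))
Σℕ-comm f = begin
  Σℕ (λ i → Σℕ (f i))           ≡⟨ trans (Σℕ≡sum (λ i → Σℕ (f i))) (sum-cong-≗ (Σℕ≡sum ∘ f)) ⟩
  sum (λ i → sum (f i))         ≡⟨ ∑-comm f ⟩
  sum (λ j → sum (λ i → f i j)) ≡⟨ trans (Σℕ≡sum (λ j → Σℕ (λ i → f i j))) (sum-cong-≗ (λ j → Σℕ≡sum (λ i → f i j))) ⟨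
  Σℕ (λ j → Σℕ (λ i → f i j))   ∎
  where open ≡-Reasoning

term≤Σℕ : ∀ {n} (f : Fin n → ℕ) i → f i ≤ Σℕ f
term≤Σℕ f zero    = m≤m+n _ _
term≤Σℕ f (suc i) = ≤-trans (term≤Σℕ (f ∘ suc) i) (m≤n+m _ _)

-- Exhaustive search through function spaces.
search-≗ : {B X Y : Set} (enum : B → X → Y) → (∀ f → ∃ λ b → enum b ≗ f) →
  ((Q : B → Set) → (∀ b → Dec (Q b)) → Dec (∃ Q)) →
  (P : (X → Y) → Set) → (∀ f → Dec (P f)) → (∀ {f g} → f ≗ g → P f → P g) → Dec (∃ P)
search-≗ enum complete searchB P P? resp with searchB (P ∘ enum) (P? ∘ enum)
... | yes (b , Pb) = yes (enum b , Pb)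
... | no ¬P∘enum   = no λ (f , Pf) →
  let (b , b≗f) = complete f in ¬P∘enum (b , resp (λ x → sym (b≗f x)) Pf)

funToFin-cong : ∀ {n m} {f g : Fin n → Fin m} → f ≗ g → funToFin f ≡ funToFin g
funToFin-cong {zero}  f≗g = refl
funToFin-cong {suc n} f≗g = cong₂ combine (f≗g zero) (funToFin-cong (f≗g ∘ suc))

-- A map (Fin n → Fin m) → (Fin k → Fin m) that is injective up to pointwise
-- equality forces n ≤ k, as it induces an injection Fin (mⁿ) → Fin (mᵏ).
injection-dimension : ∀ {m} → 1 < m → ∀ {n k} (F : (Fin n → Fin m) → Fin k → Fin m) →
  (∀ c c' → F c ≗ F c' → c ≗ c') → n ≤ k
injection-dimension {m} 1<m {n} {k} F F-injective =
  ≮⇒≥ (λ k<n → <⇒≱ (^-monoʳ-< m 1<m k<n) (injective⇒≤ f-injective))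
  where
    f : Fin (m ^ n) → Fin (m ^ k)
    f a = funToFin (F (finToFun a))
    f-injective : ∀ {a b} → f a ≡ f b → a ≡ b
    f-injective {a} {b} fa≡fb = begin
      a                              ≡⟨ funToFin-finToFin {n} {m} a ⟨
      funToFin (finToFun {m} {n} a)  ≡⟨ funToFin-cong (F-injective (finToFun a) (finToFun b) Fa≗Fb) ⟩
      funToFin (finToFun {m} {n} b)  ≡⟨ funToFin-finToFin {n} {m} b ⟩
      b                              ∎
      where
        open ≡-Reasoning
        Fa≗Fb : F (finToFun a) ≗ F (finToFun b)
        Fa≗Fb i = trans (sym (finToFun-funToFin (F (finToFun a)) i))
                        (trans (cong (λ x → finToFun {m} {k} x i) fa≡fb) (finToFun-funToFin (F (finToFun b)) i))

∀-∷ : ∀ {X : Set} {P : X → Set} {n} {w : X} {m : Fin n → X} → P w → (∀ j → P (m j)) → ∀ j → P ((w ∷ m) j)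
∀-∷ Pw Pm zero    = Pw
∀-∷ Pw Pm (suc j) = Pm j

-- Arithmetic in ℤ/pℤ, on natural-number representatives.
module Residues (p : ℕ) .{{_ : NonZero p}} where

  infix 4 _≡ₚ_
  _≡ₚ_ : ℕ → ℕ → Set
  a ≡ₚ b = a % p ≡ b % p

  ≡⇒≡ₚ : ∀ {a b} → a ≡ b → a ≡ₚ b
  ≡⇒≡ₚ = cong (_% p)

  +-congₚ : ∀ {a a' b b'} → a ≡ₚ a' → b ≡ₚ b' → a + b ≡ₚ a' + b'
  +-congₚ {a} {a'} {b} {b'} a≡a' b≡b' = begin
    (a + b) % p           ≡⟨ %-distribˡ-+ a b p ⟩
    (a % p + b % p) % p   ≡⟨ cong₂ (λ x y → (x + y) % p) a≡a' b≡b' ⟩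
    (a' % p + b' % p) % p ≡⟨ %-distribˡ-+ a' b' p ⟨
    (a' + b') % p         ∎
    where open ≡-Reasoning

  *-congₚ : ∀ {a a' b b'} → a ≡ₚ a' → b ≡ₚ b' → a * b ≡ₚ a' * b'
  *-congₚ {a} {a'} {b} {b'} a≡a' b≡b' = begin
    (a * b) % p           ≡⟨ %-distribˡ-* a b p ⟩
    (a % p * (b % p)) % p ≡⟨ cong₂ (λ x y → (x * y) % p) a≡a' b≡b' ⟩
    (a' % p * (b' % p)) % p ≡⟨ %-distribˡ-* a' b' p ⟨
    (a' * b') % p         ∎
    where open ≡-Reasoning

  Σ-congₚ : ∀ {n} {f g : Fin n → ℕ} → (∀ i → f i ≡ₚ g i) → Σℕ f ≡ₚ Σℕ g
  Σ-congₚ {zero}  f≡g = refl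
  Σ-congₚ {suc n} f≡g = +-congₚ (f≡g zero) (Σ-congₚ (f≡g ∘ suc))

  0%p : 0 % p ≡ 0
  0%p = m<n⇒m%n≡m (>-nonZero⁻¹ p)

  toℕ%p : (x : Fin p) → toℕ x % p ≡ toℕ x
  toℕ%p x = m<n⇒m%n≡m (toℕ<n x)

  toℕ-injectiveₚ : ∀ {x y : Fin p} → toℕ x ≡ₚ toℕ y → x ≡ y
  toℕ-injectiveₚ {x} {y} x≡y = toℕ-injective (trans (sym (toℕ%p x)) (trans x≡y (toℕ%p y)))

  toℕ≡ₚ0 : (x : Fin p) → toℕ x ≡ₚ 0 → toℕ x ≡ 0
  toℕ≡ₚ0 x x≡0 = trans (sym (toℕ%p x)) (trans x≡0 0%p)

  toℕ-red : ∀ m → toℕ (red p m) ≡ₚ m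
  toℕ-red m = trans (cong (_% p) (toℕ-fromℕ< _)) (m%n%n≡m%n m p)

  -ₚ_ : ℕ → ℕ
  -ₚ a = (p ∸ 1) * a

  -ₚ-inverseˡ : ∀ a → -ₚ a + a ≡ₚ 0
  -ₚ-inverseˡ a = begin
    ((p ∸ 1) * a + a) % p ≡⟨ cong (_% p) (+-comm ((p ∸ 1) * a) a) ⟩
    (suc (p ∸ 1) * a) % p ≡⟨ cong (λ q → (q * a) % p) (m+[n∸m]≡n {1} {p} (>-nonZero⁻¹ p)) ⟩
    (p * a) % p           ≡⟨ cong (_% p) (*-comm p a) ⟩
    (a * p) % p           ≡⟨ m*n%n≡0 a p ⟩
    0                     ≡⟨ 0%p ⟨
    0 % p                 ∎
    where open ≡-Reasoning

  +-cancelˡₚ : ∀ a {b c} → a + b ≡ₚ a + c → b ≡ₚ c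
  +-cancelˡₚ a {b} {c} a+b≡a+c = begin
    b % p                ≡⟨ +-congₚ (-ₚ-inverseˡ a) (refl {x = b % p}) ⟨
    (-ₚ a + a + b) % p   ≡⟨ ≡⇒≡ₚ (+-assoc (-ₚ a) a b) ⟩
    (-ₚ a + (a + b)) % p ≡⟨ +-congₚ { -ₚ a} refl a+b≡a+c ⟩
    (-ₚ a + (a + c)) % p ≡⟨ ≡⇒≡ₚ (+-assoc (-ₚ a) a c) ⟨
    (-ₚ a + a + c) % p   ≡⟨ +-congₚ (-ₚ-inverseˡ a) (refl {x = c % p}) ⟩
    c % p                ∎
    where open ≡-Reasoning

  inverse-unique : ∀ {a b} → a + b ≡ₚ 0 → a ≡ₚ -ₚ b
  inverse-unique {a} {b} a+b≡0 =
    +-cancelˡₚ b (trans (≡⇒≡ₚ (+-comm b a)) (trans a+b≡0 (trans (sym (-ₚ-inverseˡ b)) (≡⇒≡ₚ (+-comm (-ₚ b) b)))))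

  difference-zero : ∀ {a b} → a + -ₚ b ≡ₚ 0 → a ≡ₚ b
  difference-zero {a} {b} a-b≡0 =
    +-cancelˡₚ (-ₚ b) (trans (≡⇒≡ₚ (+-comm (-ₚ b) a)) (trans a-b≡0 (sym (-ₚ-inverseˡ b))))

  solve-linear : ∀ {e a x r} → e * a ≡ₚ 1 → a * x + r ≡ₚ 0 → x ≡ₚ -ₚ (e * r)
  solve-linear {e} {a} {x} {r} ea≡1 ax+r≡0 = inverse-unique (begin
    (x + e * r) % p         ≡⟨ ≡⇒≡ₚ (cong (_+ e * r) (*-identityˡ x)) ⟨
    (1 * x + e * r) % p     ≡⟨ +-congₚ (*-congₚ ea≡1 (refl {x = x % p})) (refl {x = (e * r) % p}) ⟨
    (e * a * x + e * r) % p ≡⟨ ≡⇒≡ₚ (distribute e a x r) ⟩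
    (e * (a * x + r)) % p   ≡⟨ *-congₚ (refl {x = e % p}) ax+r≡0 ⟩
    (e * 0) % p             ≡⟨ ≡⇒≡ₚ (*-zeroʳ e) ⟩
    0 % p                   ∎)
    where
      open ≡-Reasoning
      distribute : ∀ e a x r → e * a * x + e * r ≡ e * (a * x + r)
      distribute = solve-∀

  inverse : Prime p → ∀ a → ¬ (a ≡ₚ 0) → ∃ λ e → e * a ≡ₚ 1
  inverse p-prime a a≢0 with coprime-Bézout (prime⇒coprime p-prime {{r≢0}} (m%n<n a p))
    where
      r≢0 : NonZero (a % p)
      r≢0 = ≢-nonZero (λ r≡0 → a≢0 (trans r≡0 (sym 0%p)))
  ... | Bézout.+- x y 1+yr≡xp = -ₚ y , (begin
    ((p ∸ 1) * y * a) % p         ≡⟨ *-congₚ (refl {x = ((p ∸ 1) * y) % p}) (m%n%n≡m%n a p) ⟨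
    ((p ∸ 1) * y * (a % p)) % p   ≡⟨ ≡⇒≡ₚ (*-assoc (p ∸ 1) y (a % p)) ⟩
    (-ₚ (y * (a % p))) % p        ≡⟨ inverse-unique 1+yr≡0 ⟨
    1 % p                         ∎)
    where
      open ≡-Reasoning
      1+yr≡0 : 1 + y * (a % p) ≡ₚ 0
      1+yr≡0 = trans (cong (_% p) 1+yr≡xp) (trans (m*n%n≡0 x p) (sym 0%p))
  ... | Bézout.-+ x y 1+xp≡yr = y , (begin
    (y * a) % p        ≡⟨ *-congₚ (refl {x = y % p}) (m%n%n≡m%n a p) ⟨
    (y * (a % p)) % p  ≡⟨ cong (_% p) 1+xp≡yr ⟨
    (1 + x * p) % p    ≡⟨ [m+kn]%n≡m%n 1 x p ⟩
    1 % p              ∎)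
    where open ≡-Reasoning

-- Linear algebra in F_p^ℓ, computed on natural-number representatives.
module LinearAlgebra (p : ℕ) .{{_ : NonZero p}} where
  open Residues p

  ⟦_⟧ : ∀ {ℓ} → Vecₚ p ℓ → Fin ℓ → ℕ
  ⟦ v ⟧ i = toℕ (v i)

  combo : ∀ {k ℓ} → (Fin k → ℕ) → (Fin k → Fin ℓ → ℕ) → Fin ℓ → ℕ
  combo c v i = Σℕ (λ j → c j * v j i)

  infix 4 _≅_
  _≅_ : ∀ {ℓ} → Vecₚ p ℓ → (Fin ℓ → ℕ) → Set
  w ≅ f = ∀ i → ⟦ w ⟧ i ≡ₚ f i

  lincomb-≅ : ∀ {k ℓ} (c : Fin k → Fin p) (v : Fin k → Vecₚ p ℓ) →
    lincomb p c v ≅ combo (toℕ ∘ c) (⟦_⟧ ∘ v)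
  lincomb-≅ c v i = toℕ-red (combo (toℕ ∘ c) (⟦_⟧ ∘ v) i)

  ≅-unique : ∀ {ℓ} {u w : Vecₚ p ℓ} {f} → u ≅ f → w ≅ f → _≈_ p u w
  ≅-unique u≅f w≅f i = toℕ-injectiveₚ (trans (u≅f i) (sym (w≅f i)))

  ≈-≅ : ∀ {ℓ} {u w : Vecₚ p ℓ} {f} → _≈_ p u w → u ≅ f → w ≅ f
  ≈-≅ {f = f} u≈w u≅f i = subst (λ x → toℕ x ≡ₚ f i) (u≈w i) (u≅f i)

  combo-congˡₚ : ∀ {k ℓ} {c c' : Fin k → ℕ} → (∀ j → c j ≡ₚ c' j) →
    (v : Fin k → Fin ℓ → ℕ) → ∀ i → combo c v i ≡ₚ combo c' v i
  combo-congˡₚ c≡c' v i = Σ-congₚ (λ j → *-congₚ (c≡c' j) (refl {x = v j i % p}))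

  combo-congʳₚ : ∀ {k ℓ} (c : Fin k → ℕ) {v v' : Fin k → Fin ℓ → ℕ} →
    (∀ j i → v j i ≡ₚ v' j i) → ∀ i → combo c v i ≡ₚ combo c v' i
  combo-congʳₚ c v≡v' i = Σ-congₚ (λ j → *-congₚ (refl {x = c j % p}) (v≡v' j i))

  combo-+ : ∀ {k ℓ} (c d : Fin k → ℕ) (v : Fin k → Fin ℓ → ℕ) i →
    combo (λ j → c j + d j) v i ≡ combo c v i + combo d v i
  combo-+ c d v i =
    trans (Σℕ-cong (λ j → *-distribʳ-+ (v j i) (c j) (d j))) (Σℕ-+ (λ j → c j * v j i) (λ j → d j * v j i))

  combo-*ˡ : ∀ {k ℓ} a (c : Fin k → ℕ) (v : Fin k → Fin ℓ → ℕ) i →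
    combo (λ j → a * c j) v i ≡ a * combo c v i
  combo-*ˡ a c v i = trans (Σℕ-cong (λ j → *-assoc a (c j) (v j i))) (Σℕ-*ˡ a (λ j → c j * v j i))

  combo-assoc : ∀ {n k ℓ} (c : Fin n → ℕ) (d : Fin n → Fin k → ℕ) (u : Fin k → Fin ℓ → ℕ) i →
    combo c (λ j → combo (d j) u) i ≡ combo (λ t → Σℕ (λ j → c j * d j t)) u i
  combo-assoc c d u i = begin
    Σℕ (λ j → c j * Σℕ (λ t → d j t * u t i))   ≡⟨ Σℕ-cong (λ j → Σℕ-*ˡ (c j) (λ t → d j t * u t i)) ⟨
    Σℕ (λ j → Σℕ (λ t → c j * (d j t * u t i))) ≡⟨ Σℕ-comm (λ j t → c j * (d j t * u t i)) ⟩
    Σℕ (λ t → Σℕ (λ j → c j * (d j t * u t i))) ≡⟨ Σℕ-cong (λ t → Σℕ-cong (λ j → *-assoc (c j) (d j t) (u t i))) ⟨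
    Σℕ (λ t → Σℕ (λ j → c j * d j t * u t i))   ≡⟨ Σℕ-cong (λ t → Σℕ-*ʳ (u t i) (λ j → c j * d j t)) ⟩
    Σℕ (λ t → Σℕ (λ j → c j * d j t) * u t i)   ∎
    where open ≡-Reasoning

  Σ-*-combo : ∀ {k ℓ} (a : Fin ℓ → ℕ) (c : Fin k → ℕ) (v : Fin k → Fin ℓ → ℕ) →
    Σℕ (λ i → a i * combo c v i) ≡ Σℕ (λ j → c j * Σℕ (λ i → a i * v j i))
  Σ-*-combo a c v = begin
    Σℕ (λ i → a i * Σℕ (λ j → c j * v j i))   ≡⟨ Σℕ-cong (λ i → Σℕ-*ˡ (a i) (λ j → c j * v j i)) ⟨
    Σℕ (λ i → Σℕ (λ j → a i * (c j * v j i))) ≡⟨ Σℕ-comm (λ i j → a i * (c j * v j i)) ⟩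
    Σℕ (λ j → Σℕ (λ i → a i * (c j * v j i))) ≡⟨ Σℕ-cong (λ j → Σℕ-cong (λ i → exchange (a i) (c j) (v j i))) ⟩
    Σℕ (λ j → Σℕ (λ i → c j * (a i * v j i))) ≡⟨ Σℕ-cong (λ j → Σℕ-*ˡ (c j) (λ i → a i * v j i)) ⟩
    Σℕ (λ j → c j * Σℕ (λ i → a i * v j i))   ∎
    where
      open ≡-Reasoning
      exchange : ∀ a c x → a * (c * x) ≡ c * (a * x)
      exchange = solve-∀

  lincomb-cong : ∀ {k ℓ} {c c' : Fin k → Fin p} (v : Fin k → Vecₚ p ℓ) → c ≗ c' → _≈_ p (lincomb p c v) (lincomb p c' v)
  lincomb-cong v c≗c' i = cong (red p) (Σℕ-cong (λ j → cong (λ x → toℕ x * ⟦ v j ⟧ i) (c≗c' j)))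

  span-intro : ∀ {k ℓ} {w : Vecₚ p ℓ} {v : Fin k → Vecₚ p ℓ} (c : Fin k → ℕ) →
    w ≅ combo c (⟦_⟧ ∘ v) → _∈Span_ p w v
  span-intro {v = v} c w≅cv = red p ∘ c ,
    ≅-unique (λ i → trans (lincomb-≅ (red p ∘ c) v i) (combo-congˡₚ (toℕ-red ∘ c) (⟦_⟧ ∘ v) i)) w≅cv

  span-resp : ∀ {k ℓ} {w w' : Vecₚ p ℓ} {v : Fin k → Vecₚ p ℓ} → _∈Span_ p w v → _≈_ p w w' → _∈Span_ p w' v
  span-resp (c , cv≈w) w≈w' = c , λ i → trans (cv≈w i) (w≈w' i)

  span-zero : ∀ {k ℓ} {w : Vecₚ p ℓ} {v : Fin k → Vecₚ p ℓ} → (∀ i → ⟦ w ⟧ i ≡ₚ 0) → _∈Span_ p w v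
  span-zero {k} w≡0 = span-intro (λ _ → 0) (λ i → trans (w≡0 i) (≡⇒≡ₚ (sym (Σℕ-zero k))))

  span-+ : ∀ {k ℓ} {w w₁ w₂ : Vecₚ p ℓ} {v : Fin k → Vecₚ p ℓ} → (∀ i → ⟦ w ⟧ i ≡ₚ ⟦ w₁ ⟧ i + ⟦ w₂ ⟧ i) →
    _∈Span_ p w₁ v → _∈Span_ p w₂ v → _∈Span_ p w v
  span-+ {v = v} w≡w₁+w₂ (c₁ , c₁v≈w₁) (c₂ , c₂v≈w₂) =
    span-intro (λ j → toℕ (c₁ j) + toℕ (c₂ j)) λ i → trans (w≡w₁+w₂ i)
      (trans (+-congₚ (≈-≅ c₁v≈w₁ (lincomb-≅ c₁ v) i) (≈-≅ c₂v≈w₂ (lincomb-≅ c₂ v) i))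
             (≡⇒≡ₚ (sym (combo-+ (toℕ ∘ c₁) (toℕ ∘ c₂) (⟦_⟧ ∘ v) i))))

  -- coefficients of Σⱼ cⱼ vⱼ with respect to u, when vⱼ = Σₜ dⱼₜ uₜ
  compose : ∀ {n k} → (Fin n → Fin p) → (Fin n → Fin k → Fin p) → Fin k → Fin p
  compose c d t = red p (Σℕ (λ j → toℕ (c j) * toℕ (d j t)))

  lincomb-compose : ∀ {n k ℓ} {v : Fin n → Vecₚ p ℓ} {u : Fin k → Vecₚ p ℓ} (d : Fin n → Fin k → Fin p) →
    (∀ j → _≈_ p (lincomb p (d j) u) (v j)) → ∀ c → _≈_ p (lincomb p c v) (lincomb p (compose c d) u)
  lincomb-compose {v = v} {u} d du≈v c = ≅-unique (λ i → begin
    ⟦ lincomb p c v ⟧ i % p                                     ≡⟨ lincomb-≅ c v i ⟩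
    combo (toℕ ∘ c) (⟦_⟧ ∘ v) i % p                             ≡⟨ combo-congʳₚ (toℕ ∘ c) v≅du i ⟩
    combo (toℕ ∘ c) (λ j → combo (toℕ ∘ d j) (⟦_⟧ ∘ u)) i % p   ≡⟨ ≡⇒≡ₚ (combo-assoc (toℕ ∘ c) (λ j t → toℕ (d j t)) (⟦_⟧ ∘ u) i) ⟩
    combo (λ t → Σℕ (λ j → toℕ (c j) * toℕ (d j t))) (⟦_⟧ ∘ u) i % p
      ≡⟨ combo-congˡₚ (λ t → sym (toℕ-red (Σℕ (λ j → toℕ (c j) * toℕ (d j t))))) (⟦_⟧ ∘ u) i ⟩
    combo (toℕ ∘ compose c d) (⟦_⟧ ∘ u) i % p                   ∎) (lincomb-≅ (compose c d) u)
    where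
      open ≡-Reasoning
      v≅du : ∀ j i → ⟦ v j ⟧ i ≡ₚ combo (toℕ ∘ d j) (⟦_⟧ ∘ u) i
      v≅du j = ≈-≅ (du≈v j) (lincomb-≅ (d j) u)

  span-trans : ∀ {n k ℓ} {w : Vecₚ p ℓ} {v : Fin n → Vecₚ p ℓ} {u : Fin k → Vecₚ p ℓ} →
    _∈Span_ p w v → (∀ j → _∈Span_ p (v j) u) → _∈Span_ p w u
  span-trans (c , cv≈w) v⊆u =
    compose c (proj₁ ∘ v⊆u) , λ i → trans (sym (lincomb-compose (proj₁ ∘ v⊆u) (proj₂ ∘ v⊆u) c i)) (cv≈w i)

  isZero-≅ : ∀ {ℓ} {w : Vecₚ p ℓ} {f} → w ≅ f → (∀ i → f i ≡ₚ 0) → isZeroVec p w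
  isZero-≅ {w = w} w≅f f≡0 i = toℕ≡ₚ0 (w i) (trans (w≅f i) (f≡0 i))

  zero-combination : ∀ {k ℓ} (c : Fin k → Fin p) (v : Fin k → Vecₚ p ℓ) → isZeroVec p (lincomb p c v) →
    ∀ i → combo (toℕ ∘ c) (⟦_⟧ ∘ v) i ≡ₚ 0
  zero-combination c v cv≡0 i = trans (sym (lincomb-≅ c v i)) (cong (_% p) (cv≡0 i))

  independent-zero : ∀ {k ℓ} {v : Fin k → Vecₚ p ℓ} → LinIndep p v →
    (c : Fin k → ℕ) → (∀ i → combo c (⟦_⟧ ∘ v) i ≡ₚ 0) → ∀ j → c j ≡ₚ 0
  independent-zero {v = v} ind c cv≡0 j = begin
    c j % p               ≡⟨ toℕ-red (c j) ⟨
    toℕ (red p (c j)) % p ≡⟨ cong (_% p) (ind (red p ∘ c) reduced≡0 j) ⟩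
    0 % p                 ∎
    where
      open ≡-Reasoning
      reduced≡0 : isZeroVec p (lincomb p (red p ∘ c) v)
      reduced≡0 = isZero-≅ (lincomb-≅ (red p ∘ c) v)
        (λ i → trans (combo-congˡₚ (toℕ-red ∘ c) (⟦_⟧ ∘ v) i) (cv≡0 i))

  independent-injective : ∀ {k ℓ} {v : Fin k → Vecₚ p ℓ} → LinIndep p v →
    ∀ {c c'} → _≈_ p (lincomb p c v) (lincomb p c' v) → c ≗ c'
  independent-injective {k} {ℓ} {v} ind {c} {c'} cv≈c'v j =
    toℕ-injectiveₚ (difference-zero (independent-zero ind d d-vanishes j))
    where
      open ≡-Reasoning
      V : Fin k → Fin ℓ → ℕ
      V = ⟦_⟧ ∘ v
      -- the coefficients of c - c'
      d : Fin k → ℕ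
      d j = toℕ (c j) + -ₚ toℕ (c' j)
      d-vanishes : ∀ i → combo d V i ≡ₚ 0
      d-vanishes i = begin
        combo d V i % p                                   ≡⟨ ≡⇒≡ₚ (combo-+ (toℕ ∘ c) (λ j → -ₚ toℕ (c' j)) V i) ⟩
        (combo (toℕ ∘ c) V i + combo (λ j → -ₚ toℕ (c' j)) V i) % p
          ≡⟨ +-congₚ (trans (sym (≈-≅ cv≈c'v (lincomb-≅ c v) i)) (lincomb-≅ c' v i)) (≡⇒≡ₚ (combo-*ˡ (p ∸ 1) (toℕ ∘ c') V i)) ⟩
        (combo (toℕ ∘ c') V i + -ₚ combo (toℕ ∘ c') V i) % p ≡⟨ ≡⇒≡ₚ (+-comm (combo (toℕ ∘ c') V i) _) ⟩
        (-ₚ combo (toℕ ∘ c') V i + combo (toℕ ∘ c') V i) % p ≡⟨ -ₚ-inverseˡ (combo (toℕ ∘ c') V i) ⟩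
        0 % p                                              ∎

  extend-independent : Prime p → ∀ {k ℓ} (v : Fin (suc k) → Vecₚ p ℓ) →
    LinIndep p (v ∘ suc) → ¬ _∈Span_ p (v zero) (v ∘ suc) → LinIndep p v
  extend-independent p-prime {k} {ℓ} v ind v₀∉ c cv≡0 = by-cases (toℕ (c zero) ≟ 0)
    where
      c₀ : ℕ
      c₀ = toℕ (c zero)
      c₊ : Fin k → ℕ
      c₊ = toℕ ∘ c ∘ suc
      V₊ : Fin k → Fin ℓ → ℕ
      V₊ = ⟦_⟧ ∘ v ∘ suc
      vanishes : ∀ i → c₀ * ⟦ v zero ⟧ i + combo c₊ V₊ i ≡ₚ 0
      vanishes = zero-combination c v cv≡0
      by-cases : Dec (c₀ ≡ 0) → ∀ j → toℕ (c j) ≡ 0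
      by-cases (yes c₀≡0) zero    = c₀≡0
      by-cases (yes c₀≡0) (suc j) = ind (c ∘ suc) rest≡0 j
        where
          rest≡0 : isZeroVec p (lincomb p (c ∘ suc) (v ∘ suc))
          rest≡0 = isZero-≅ (lincomb-≅ (c ∘ suc) (v ∘ suc))
            (λ i → subst (λ a → a * ⟦ v zero ⟧ i + combo c₊ V₊ i ≡ₚ 0) c₀≡0 (vanishes i))
      by-cases (no c₀≢0) = ⊥-elim (v₀∉ (v₀∈ (inverse p-prime c₀ (c₀≢0 ∘ toℕ≡ₚ0 (c zero)))))
        where
          v₀∈ : (∃ λ e → e * c₀ ≡ₚ 1) → _∈Span_ p (v zero) (v ∘ suc)
          v₀∈ (e , ec₀≡1) = span-intro (λ j → -ₚ (e * c₊ j)) λ i →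
            trans (solve-linear {e} {c₀} {⟦ v zero ⟧ i} ec₀≡1 (vanishes i)) (≡⇒≡ₚ (sym (begin
              combo (λ j → -ₚ (e * c₊ j)) V₊ i ≡⟨ combo-*ˡ (p ∸ 1) (λ j → e * c₊ j) V₊ i ⟩
              -ₚ combo (λ j → e * c₊ j) V₊ i    ≡⟨ cong -ₚ_ (combo-*ˡ e c₊ V₊ i) ⟩
              -ₚ (e * combo c₊ V₊ i)            ∎)))
            where open ≡-Reasoning

  independent-bound : 1 < p → ∀ {n k ℓ} {v : Fin n → Vecₚ p ℓ} {u : Fin k → Vecₚ p ℓ} →
    LinIndep p v → (∀ j → _∈Span_ p (v j) u) → n ≤ k
  independent-bound 1<p {n} {k} {v = v} {u} ind v⊆u =
    injection-dimension 1<p (λ c → compose c d) λ c c' cd≗c'd → independent-injective ind λ i →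
      trans (lincomb-compose d du≈v c i) (trans (lincomb-cong u cd≗c'd i) (sym (lincomb-compose d du≈v c' i)))
    where
      -- c ↦ compose c d sends the coefficients of Σⱼ cⱼ vⱼ to its coefficients in u
      d : Fin n → Fin k → Fin p
      d = proj₁ ∘ v⊆u
      du≈v : ∀ j → _≈_ p (lincomb p (d j) u) (v j)
      du≈v = proj₂ ∘ v⊆u

  span? : ∀ {k ℓ} (v : Fin k → Vecₚ p ℓ) (w : Vecₚ p ℓ) → Dec (_∈Span_ p w v)
  span? v w = search-≗ finToFun (λ c → funToFin c , finToFun-funToFin c) (λ Q Q? → any? Q?)
    (λ c → _≈_ p (lincomb p c v) w) (λ c → all? (λ i → lincomb p c v i Fin.≟ w i))
    (λ c≗c' cv≈w i → trans (sym (lincomb-cong v c≗c' i)) (cv≈w i))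

-- The hyperplane A^⊥ = { x | Σᵢ aᵢ xᵢ ≡ 0 } of F_p^(1+ℓ'), when a₀ ≢ 0.
module Hyperplane (p : ℕ) .{{_ : NonZero p}} (p-prime : Prime p)
                  {ℓ'} (A : Vecₚ p (suc ℓ')) (A₀≢0 : ¬ toℕ (A zero) ≡ 0) where
  open Residues p
  open LinearAlgebra p

  1<p : 1 < p
  1<p = nonTrivial⇒n>1 p {{prime⇒nonTrivial p-prime}}

  a₀-invertible : ∃ λ e → e * ⟦ A ⟧ zero ≡ₚ 1
  a₀-invertible = inverse p-prime (⟦ A ⟧ zero) (A₀≢0 ∘ toℕ≡ₚ0 (A zero))

  ∈⊥⇒≡ₚ0 : ∀ {x} → _∈⊥_ p x A → Σℕ (λ i → ⟦ A ⟧ i * ⟦ x ⟧ i) ≡ₚ 0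
  ∈⊥⇒≡ₚ0 x∈⊥ = trans x∈⊥ (sym 0%p)

  ⊥-closed : ∀ {k} (c : Fin k → Fin p) {v : Fin k → Vecₚ p (suc ℓ')} →
    (∀ j → _∈⊥_ p (v j) A) → _∈⊥_ p (lincomb p c v) A
  ⊥-closed {k} c {v} v∈⊥ = trans (begin
    Σℕ (λ i → ⟦ A ⟧ i * ⟦ lincomb p c v ⟧ i) % p   ≡⟨ Σ-congₚ (λ i → *-congₚ (refl {x = ⟦ A ⟧ i % p}) (lincomb-≅ c v i)) ⟩
    Σℕ (λ i → ⟦ A ⟧ i * combo (toℕ ∘ c) V i) % p  ≡⟨ ≡⇒≡ₚ (Σ-*-combo ⟦ A ⟧ (toℕ ∘ c) V) ⟩
    Σℕ (λ j → toℕ (c j) * Σℕ (λ i → ⟦ A ⟧ i * V j i)) % p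
      ≡⟨ Σ-congₚ (λ j → *-congₚ (refl {x = toℕ (c j) % p}) (∈⊥⇒≡ₚ0 {v j} (v∈⊥ j))) ⟩
    Σℕ (λ j → toℕ (c j) * 0) % p                   ≡⟨ ≡⇒≡ₚ (trans (Σℕ-cong (*-zeroʳ ∘ toℕ ∘ c)) (Σℕ-zero k)) ⟩
    0 % p                                          ∎) 0%p
    where
      open ≡-Reasoning
      V : Fin k → Fin (suc ℓ') → ℕ
      V = ⟦_⟧ ∘ v

  ⊥-determined-by-tail : ∀ {x y} → _∈⊥_ p x A → _∈⊥_ p y A → (∀ t → x (suc t) ≡ y (suc t)) → _≈_ p x y
  ⊥-determined-by-tail {x} {y} x∈⊥ y∈⊥ tails (suc t) = tails t
  ⊥-determined-by-tail {x} {y} x∈⊥ y∈⊥ tails zero with a₀-invertible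
  ... | e , ea₀≡1 =
    toℕ-injectiveₚ (trans (solve-linear {e} {a₀} {⟦ x ⟧ zero} ea₀≡1 (∈⊥⇒≡ₚ0 {x} x∈⊥))
                          (sym (solve-linear {e} {a₀} {⟦ y ⟧ zero} ea₀≡1 y∈⊥')))
    where
      a₀ : ℕ
      a₀ = ⟦ A ⟧ zero
      rest : Vecₚ p (suc ℓ') → ℕ
      rest z = Σℕ (λ t → ⟦ A ⟧ (suc t) * ⟦ z ⟧ (suc t))
      y∈⊥' : a₀ * ⟦ y ⟧ zero + rest x ≡ₚ 0
      y∈⊥' = subst (λ r → a₀ * ⟦ y ⟧ zero + r ≡ₚ 0)
        (Σℕ-cong (λ t → cong (λ z → ⟦ A ⟧ (suc t) * toℕ z) (sym (tails t)))) (∈⊥⇒≡ₚ0 {y} y∈⊥)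

  ⊥-independent-bound : ∀ {n} {v : Fin n → Vecₚ p (suc ℓ')} → LinIndep p v → (∀ j → _∈⊥_ p (v j) A) → n ≤ ℓ'
  ⊥-independent-bound {v = v} ind v∈⊥ =
    injection-dimension 1<p (λ c t → lincomb p c v (suc t)) λ c c' tails →
      independent-injective ind (⊥-determined-by-tail (⊥-closed c {v} v∈⊥) (⊥-closed c' {v} v∈⊥) tails)

  ⊥-spanned : ∀ {k} {u : Fin k → Vecₚ p (suc ℓ')} → LinIndep p u → (∀ j → _∈⊥_ p (u j) A) → ℓ' ≤ k →
    ∀ x → _∈⊥_ p x A → _∈Span_ p x u
  ⊥-spanned {u = u} ind u∈⊥ ℓ'≤k x x∈⊥ = decidable-stable (span? u x) λ x∉u →
    1+n≰n (≤-trans (⊥-independent-bound {v = x ∷ u} (extend-independent p-prime (x ∷ u) ind x∉u)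
                                        (∀-∷ {P = λ z → _∈⊥_ p z A} x∈⊥ u∈⊥))
                   ℓ'≤k)

indicator : Bool → ℕ
indicator true  = 1
indicator false = 0

indicator-split : ∀ a b → (b ≡ true → a ≡ true) → indicator a ≡ indicator b + indicator (a ∧ not b)
indicator-split true  true  _    = refl
indicator-split true  false _    = refl
indicator-split false false _    = refl
indicator-split false true  b⇒a with b⇒a refl
... | ()

indicator-false : ∀ a → ¬ a ≡ true → indicator a ≡ 0
indicator-false true  a≢true = ⊥-elim (a≢true refl)
indicator-false false _      = refl

∖-true : ∀ a b → ¬ (a ≡ true → b ≡ true) → a ∧ not b ≡ true
∖-true true  false _     = refl
∖-true true  true  a⇏b   = ⊥-elim (a⇏b (λ _ → refl))
∖-true false _     a⇏b   = ⊥-elim (a⇏b (λ ()))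

-- Subsets of Fin ℓ, as Bool-valued functions; the set S_A and its minimal elements.
module Subsets (p : ℕ) .{{_ : NonZero p}} (1<p : 1 < p) {ℓ : ℕ} (A : Vecₚ p ℓ) where
  open Residues p
  open LinearAlgebra p

  Sub : Set
  Sub = Fin ℓ → Bool

  -- the coordinates of the {0,1}-vector of a subset (this needs 1 < p)
  embed-indicator : ∀ (x : Sub) i → ⟦ embed p x ⟧ i ≡ indicator (x i)
  embed-indicator x i with x i
  ... | true  = trans (toℕ-fromℕ< _) (m<n⇒m%n≡m 1<p)
  ... | false = trans (toℕ-fromℕ< _) 0%p

  embed-cong : ∀ {x y : Sub} → x ≗ y → _≈_ p (embed p x) (embed p y)
  embed-cong {x} {y} x≗y i =
    toℕ-injective (trans (embed-indicator x i) (trans (cong indicator (x≗y i)) (sym (embed-indicator y i))))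

  count : Sub → ℕ
  count x = Σℕ (indicator ∘ x)

  _∖_ : Sub → Sub → Sub
  (x ∖ y) i = x i ∧ not (y i)

  embed-split : ∀ {x y : Sub} → _⊆_ p y x → ∀ i → ⟦ embed p x ⟧ i ≡ ⟦ embed p y ⟧ i + ⟦ embed p (x ∖ y) ⟧ i
  embed-split {x} {y} y⊆x i = begin
    ⟦ embed p x ⟧ i                                   ≡⟨ embed-indicator x i ⟩
    indicator (x i)                                  ≡⟨ indicator-split (x i) (y i) (y⊆x i) ⟩
    indicator (y i) + indicator ((x ∖ y) i)          ≡⟨ cong₂ _+_ (embed-indicator y i) (embed-indicator (x ∖ y) i) ⟨
    ⟦ embed p y ⟧ i + ⟦ embed p (x ∖ y) ⟧ i          ∎
    where open ≡-Reasoning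

  nonEmpty-count : ∀ {x : Sub} → nonEmpty p x → 1 ≤ count x
  nonEmpty-count {x} (i , xᵢ) = subst (λ b → indicator b ≤ count x) xᵢ (term≤Σℕ (indicator ∘ x) i)

  ∖-nonEmpty : ∀ {x y : Sub} → ¬ _⊆_ p x y → nonEmpty p (x ∖ y)
  ∖-nonEmpty {x} {y} x⊈y with ¬∀⟶∃¬ ℓ _ (λ i → (x i Bool.≟ true) →-dec (y i Bool.≟ true)) x⊈y
  ... | i , xᵢ⇏yᵢ = i , ∖-true (x i) (y i) xᵢ⇏yᵢ

  proper-part-smaller : ∀ {x y : Sub} → _⊆_ p y x → nonEmpty p y → ¬ _⊆_ p x y →
    count y < count x × count (x ∖ y) < count x
  proper-part-smaller {x} {y} y⊆x y≠∅ x⊈y =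
    subst (count y <_) (sym count-split) (m<m+n (count y) (nonEmpty-count (∖-nonEmpty x⊈y))) ,
    subst (count (x ∖ y) <_) (sym count-split) (m<n+m (count (x ∖ y)) (nonEmpty-count y≠∅))
    where
      count-split : count x ≡ count y + count (x ∖ y)
      count-split = trans (Σℕ-cong (λ i → indicator-split (x i) (y i) (y⊆x i)))
                          (Σℕ-+ (indicator ∘ y) (indicator ∘ (x ∖ y)))

  inS-difference : ∀ {x y : Sub} → inS p A x → inS p A y → _⊆_ p y x → inS p A (x ∖ y)
  inS-difference {x} {y} x∈S y∈S y⊆x = trans (+-cancelˡₚ (weight y) (begin
    (weight y + weight (x ∖ y)) % p ≡⟨ ≡⇒≡ₚ weight-split ⟨
    weight x % p                    ≡⟨ trans x∈S (sym y∈S) ⟩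
    weight y % p                    ≡⟨ ≡⇒≡ₚ (+-identityʳ (weight y)) ⟨
    (weight y + 0) % p              ∎)) 0%p
    where
      open ≡-Reasoning
      weight : Sub → ℕ
      weight z = Σℕ (λ i → ⟦ A ⟧ i * ⟦ embed p z ⟧ i)
      weight-split : weight x ≡ weight y + weight (x ∖ y)
      weight-split = trans
        (Σℕ-cong (λ i → trans (cong (⟦ A ⟧ i *_) (embed-split y⊆x i)) (*-distribˡ-+ (⟦ A ⟧ i) _ _)))
        (Σℕ-+ (λ i → ⟦ A ⟧ i * ⟦ embed p y ⟧ i) (λ i → ⟦ A ⟧ i * ⟦ embed p (x ∖ y) ⟧ i))

  empty-in-span : ∀ {k} {u : Fin k → Vecₚ p ℓ} {x : Sub} → ¬ nonEmpty p x → _∈Span_ p (embed p x) u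
  empty-in-span {x = x} x≡∅ =
    span-zero (λ i → ≡⇒≡ₚ (trans (embed-indicator x i) (indicator-false (x i) (λ xᵢ → x≡∅ (i , xᵢ)))))

  SpanS-⊆ : ∀ {k} {u : Fin k → Vecₚ p ℓ} → (∀ x → inS p A x → _∈Span_ p (embed p x) u) →
    ∀ {w} → SpanS p A w → _∈Span_ p w u
  SpanS-⊆ S⊆u (_ , v , v∈S , w∈v) = span-trans w∈v λ t →
    let (x , x∈S , x≈vₜ) = v∈S t in span-resp (S⊆u x x∈S) x≈vₜ

  search-subsets : (P : Sub → Set) → (∀ x → Dec (P x)) → (∀ {x y : Sub} → x ≗ y → P x → P y) → Dec (∃ P)
  search-subsets = search-≗ Vec.lookup (λ x → Vec.tabulate x , lookup∘tabulate x) (λ Q Q? → anySubset? Q?)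

  inS? : ∀ (x : Sub) → Dec (inS p A x)
  inS? x = _ ≟ 0

  nonEmpty? : ∀ (x : Sub) → Dec (nonEmpty p x)
  nonEmpty? x = any? (λ i → x i Bool.≟ true)

  ⊆? : ∀ (x y : Sub) → Dec (_⊆_ p x y)
  ⊆? x y = all? (λ i → (x i Bool.≟ true) →-dec (y i Bool.≟ true))

  inS-cong : ∀ {x y : Sub} → x ≗ y → inS p A x → inS p A y
  inS-cong x≗y x∈S =
    trans (cong (_% p) (Σℕ-cong (λ i → cong (λ z → ⟦ A ⟧ i * toℕ z) (sym (embed-cong x≗y i))))) x∈S

  nonEmpty-cong : ∀ {x y : Sub} → x ≗ y → nonEmpty p x → nonEmpty p y
  nonEmpty-cong x≗y (i , xᵢ) = i , trans (sym (x≗y i)) xᵢ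

  ⊆-cong : ∀ {x x' y y' : Sub} → x ≗ x' → y ≗ y' → _⊆_ p x y → _⊆_ p x' y'
  ⊆-cong x≗x' y≗y' x⊆y i x'ᵢ = trans (sym (y≗y' i)) (x⊆y i (trans (x≗x' i) x'ᵢ))

  ProperPart : Sub → Sub → Set
  ProperPart x y = inS p A y × nonEmpty p y × _⊆_ p y x × ¬ _⊆_ p x y

  proper-part? : ∀ (x : Sub) → Dec (∃ (ProperPart x))
  proper-part? x = search-subsets (ProperPart x)
    (λ y → inS? y ×-dec nonEmpty? y ×-dec ⊆? y x ×-dec ¬? (⊆? x y))
    (λ y≗y' (y∈S , y≠∅ , y⊆x , x⊈y) →
      inS-cong y≗y' y∈S , nonEmpty-cong y≗y' y≠∅ , ⊆-cong y≗y' (λ _ → refl) y⊆x ,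
      x⊈y ∘ ⊆-cong {x} (λ _ → refl) (λ i → sym (y≗y' i)))

  minimal-if-no-proper-part : ∀ {x : Sub} → inS p A x → nonEmpty p x → ¬ ∃ (ProperPart x) → Minimal p A x
  minimal-if-no-proper-part {x} x∈S x≠∅ none = x∈S , x≠∅ , λ y y∈S y≠∅ y⊆x →
    decidable-stable (⊆? x y) (λ x⊈y → none (y , y∈S , y≠∅ , y⊆x , x⊈y))

  -- Below every element of S_A outside the span of u lies a minimal element of
  -- S_A outside the span of u: split x into a proper part y and x ∖ y; if both
  -- were in the span, so would be x.  Recursion on count x.
  minimal-outside : ∀ {k} (u : Fin k → Vecₚ p ℓ) x → inS p A x → ¬ _∈Span_ p (embed p x) u →
    ∃ λ y → Minimal p A y × ¬ _∈Span_ p (embed p y) u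
  minimal-outside u x = descend (suc (count x)) x (n<1+n (count x))
    where
      descend : ∀ bound x → count x < bound → inS p A x → ¬ _∈Span_ p (embed p x) u →
        ∃ λ y → Minimal p A y × ¬ _∈Span_ p (embed p y) u
      descend (suc bound) x x<bound x∈S x∉u with proper-part? x
      ... | no none = x , minimal-if-no-proper-part x∈S x≠∅ none , x∉u
        where
          x≠∅ : nonEmpty p x
          x≠∅ = decidable-stable (nonEmpty? x) (x∉u ∘ empty-in-span)
      ... | yes (y , y∈S , y≠∅ , y⊆x , x⊈y) with span? u (embed p y) | span? u (embed p (x ∖ y))
      ...   | no y∉u  | _       =
        descend bound y (<-≤-trans (proj₁ (proper-part-smaller y⊆x y≠∅ x⊈y)) (≤-pred x<bound)) y∈S y∉u
      ...   | yes _   | no z∉u  =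
        descend bound (x ∖ y) (<-≤-trans (proj₂ (proper-part-smaller y⊆x y≠∅ x⊈y)) (≤-pred x<bound))
          (inS-difference x∈S y∈S y⊆x) z∉u
      ...   | yes y∈u | yes z∈u = ⊥-elim (x∉u (span-+ (≡⇒≡ₚ ∘ embed-split y⊆x) y∈u z∈u))

-- Greedy construction of an independent family of minimal elements whose span
-- contains S_A, for A^⊥ ⊆ F_p^(1+ℓ') with a₀ ≢ 0.
module Saturation (p : ℕ) .{{_ : NonZero p}} (p-prime : Prime p)
                  {ℓ'} (A : Vecₚ p (suc ℓ')) (A₀≢0 : ¬ toℕ (A zero) ≡ 0) where
  open LinearAlgebra p
  open Hyperplane p p-prime A A₀≢0
  open Subsets p 1<p A

  embeds : ∀ {k} → (Fin k → Sub) → Fin k → Vecₚ p (suc ℓ')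
  embeds m j = embed p (m j)

  outside? : ∀ {k} (u : Fin k → Vecₚ p (suc ℓ')) → Dec (∃ λ x → inS p A x × ¬ _∈Span_ p (embed p x) u)
  outside? u = search-subsets _ (λ x → inS? x ×-dec ¬? (span? u (embed p x)))
    (λ x≗y (x∈S , x∉u) → inS-cong x≗y x∈S , x∉u ∘ λ y∈u → span-resp y∈u (λ i → sym (embed-cong x≗y i)))

  Saturated : Set
  Saturated = Σ ℕ λ k → Σ (Fin k → Sub) λ m →
    (∀ j → Minimal p A (m j)) × LinIndep p (embeds m) × (∀ x → inS p A x → _∈Span_ p (embed p x) (embeds m))

  -- Independent families in A^⊥ have at most ℓ' members,
  -- so this stops after at most ℓ' steps; k + steps ≡ ℓ' bounds the recursion.
  saturate : ∀ steps {k} (m : Fin k → Sub) → (∀ j → Minimal p A (m j)) → LinIndep p (embeds m) →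
    k + steps ≡ ℓ' → Saturated
  saturate steps {k} m m-min m-ind k+steps≡ℓ' with outside? (embeds m)
  ... | no none = k , m , m-min , m-ind , λ x x∈S →
    decidable-stable (span? (embeds m) (embed p x)) (λ x∉m → none (x , x∈S , x∉m))
  ... | yes (x , x∈S , x∉m) with minimal-outside (embeds m) x x∈S x∉m
  ...   | y , y-min , y∉m = continue steps k+steps≡ℓ'
    where
      ym-min : ∀ j → Minimal p A ((y ∷ m) j)
      ym-min = ∀-∷ {P = Minimal p A} y-min m-min
      ym-ind : LinIndep p (embeds (y ∷ m))
      ym-ind = extend-independent p-prime (embeds (y ∷ m)) m-ind y∉m
      k<ℓ' : suc k ≤ ℓ'
      k<ℓ' = ⊥-independent-bound {v = embeds (y ∷ m)} ym-ind (proj₁ ∘ ym-min)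
      continue : ∀ steps → k + steps ≡ ℓ' → Saturated
      continue zero    k+0≡ℓ'   = ⊥-elim (1+n≰n (subst (suc k ≤_) (trans (sym k+0≡ℓ') (+-identityʳ k)) k<ℓ'))
      continue (suc s) k+1+s≡ℓ' = saturate s (y ∷ m) ym-min ym-ind (trans (sym (+-suc k s)) k+1+s≡ℓ')

  -- If dim(A) = ℓ', a saturated family is a basis of A^⊥: its span contains the
  -- ℓ' independent vectors of a basis of span S_A, so it has at least ℓ' members.
  saturated-basis : (b : Fin ℓ' → Vecₚ p (suc ℓ')) → IsBasis p (SpanS p A) b → Saturated →
    Σ ℕ λ k → Σ (Fin k → Sub) λ m →
      (∀ j → Minimal p A (m j)) × IsBasis p (λ x → _∈⊥_ p x A) (embeds m)
  saturated-basis b (b∈SpanS , b-ind , _) (k , m , m-min , m-ind , S⊆m) =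
    k , m , m-min , proj₁ ∘ m-min , m-ind , ⊥-spanned m-ind (proj₁ ∘ m-min) ℓ'≤k
    where
      ℓ'≤k : ℓ' ≤ k
      ℓ'≤k = independent-bound 1<p b-ind (λ j → SpanS-⊆ S⊆m (b∈SpanS j))

proposition3p3 : (p : ℕ) .{{_ : NonZero p}} → Prime p →
    (ℓ : ℕ) → 1 ≤ ℓ → (A : Vecₚ p ℓ) → (∀ i → ¬ (toℕ (A i) ≡ 0)) →
    DimIs p A (ℓ ∸ 1) →
    Σ ℕ λ k → Σ (Fin k → (Fin ℓ → Bool)) λ m →
      (∀ j → Minimal p A (m j)) × IsBasis p (λ x → _∈⊥_ p x A) (λ j → embed p (m j))
proposition3p3 p p-prime zero     () A A≢0 dim
proposition3p3 p p-prime (suc ℓ') _  A A≢0 (b , b-basis) =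
  saturated-basis b b-basis (saturate ℓ' (λ ()) (λ ()) (λ _ _ ()) refl)
  where open Saturation p p-prime A (A≢0 zero)
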